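{- Let $x$ be a bordered word of length $n \geq 1$ and let $e = \operatorname{ice}(x)$. Then $$\operatorname{nnp}(x) \leq \frac{e}{2} + 1 + \frac{\ln(n/2)}{\ln\bigl(e/(e-1)\bigr)}.$$
   Context: Let $x$ be a finite nonempty word of length $n$. An integer $p$ with $1 \le p \le n$ is a period of $x$ if $x[i]=x[i+p]$ for all $1 \le i \le n-p$. A period is nontrivial if $p<n$. $\operatorname{nnp}(x)$ denotes the number of nontrivial periods of $x$, and $\operatorname{per}(x)$ denotes the least period of $x$. The exponent of $x$ is $\exp(x) = |x|/\operatorname{per}(x)$. The initial critical exponent of $x$ is $\operatorname{ice}(x) = \sup\{\exp(w) : w \text{ a nonempty prefix of } x\}$. A border of $x$ is a word $w$ with $0<|w|<|x|$ that is both a prefix and a suffix of $x$ (overlapping allowed); $x$ is bordered if it has at least one border. -}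

module Defs where

open import Data.Nat as ℕ using (ℕ; zero; suc; _≤_; _<_; _∸_)
open import Data.Fin using (Fin; toℕ)
open import Data.Fin.Properties using (all?)
open import Data.List using (List; []; _∷_; length; lookup; take; filter; map; upTo; foldr; _++_)
open import Data.Product using (Σ; _×_; ∃; ∃-syntax)
open import Data.Integer using (+_)
open import Data.Rational using (ℚ; _/_; _⊔_; _*_; 0ℚ; 1ℚ)
open import Relation.Binary.PropositionalEquality using (_≡_)
open import Relation.Binary.Definitions using (DecidableEquality)
open import Relation.Nullary using (Dec)
open import Relation.Nullary.Decidable using (_×-dec_; _→-dec_)
import Data.Nat.Properties as ℕP

module _ {A : Set} (_≟_ : DecidableEquality A) where

  IsPeriod : List A → ℕ → Set
  IsPeriod x p = (1 ≤ p) × (p ≤ length x) ×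
    ((i j : Fin (length x)) → toℕ j ≡ toℕ i ℕ.+ p → lookup x i ≡ lookup x j)

  isPeriod? : (x : List A) (p : ℕ) → Dec (IsPeriod x p)
  isPeriod? x p = (1 ℕP.≤? p) ×-dec (p ℕP.≤? length x) ×-dec
    all? (λ i → all? (λ j → (toℕ j ℕP.≟ toℕ i ℕ.+ p) →-dec (lookup x i ≟ lookup x j)))

  nnp : List A → ℕ
  nnp x = length (filter (isPeriod? x) (map suc (upTo (length x ∸ 1))))

  -- least period, written as suc of the least k with k+1 a period
  -- (for nonempty x, k = |x|-1 always qualifies, so the default 0 is never used)
  private
    firstOr : ℕ → List ℕ → ℕ
    firstOr d [] = d
    firstOr d (k ∷ _) = k

  per : List A → ℕ
  per x = suc (firstOr 0 (filter (λ k → isPeriod? x (suc k)) (upTo (length x))))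

  exp : List A → ℚ
  exp x = (+ length x) / per x

  ice : List A → ℚ
  ice x = foldr (λ m r → exp (take m x) ⊔ r) 0ℚ (map suc (upTo (length x)))

  Bordered : List A → Set
  Bordered x = Σ (List A) λ w → (0 < length w) × (length w < length x) ×
    (∃[ u ] x ≡ w ++ u) × (∃[ v ] x ≡ v ++ w)

_^ℚ_ : ℚ → ℕ → ℚ
q ^ℚ zero = 1ℚ
q ^ℚ suc k = q * (q ^ℚ k)

{-# OPTIONS --safe #-}

-- Split the nontrivial periods p of x into short ones (2p ≤ |x|) and long ones.
-- A short period and per(x) are two periods whose sum is at most |x|, so by the
-- Fine–Wilf argument every short period is a multiple of per(x); hence there are
-- at most |x| / (2 per(x)) ≤ e/2 of them. If p < q are periods, the prefix of x of
-- length |x| − p has period q − p, so |x| − p ≤ e (q − p), i.e.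
-- e (|x| − q) ≤ (e − 1) (|x| − p). Along the long periods p₀ < … < p_c this gives
-- 1 ≤ |x| − p_c ≤ ((e − 1)/e)^c (|x| − p₀) < ((e − 1)/e)^c |x|/2, so
-- nnp(x) ≤ e/2 + 1 + c with (e/(e − 1))^c ≤ |x|/2, and raising this to the power b
-- gives the claim for every a/b ≤ c.
module Submission where

open import Defs
open import Data.Nat using (ℕ; NonZero; _≤_)
open import Data.List using (List; length)
open import Data.Integer using (+_)
open import Data.Rational using (ℚ; _/_; _+_; _-_; _*_; 1ℚ)
import Data.Rational as Q
open import Relation.Binary.Definitions using (DecidableEquality)

open import Algebra.Bundles using (CommutativeRing)
open import Data.Fin as Fin using (Fin; toℕ)
import Data.Fin.Properties as Fin
import Data.Integer as ℤ
import Data.Integer.Properties as ℤ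
open import Data.List using ([]; _∷_; _++_; lookup; take; filter; map; upTo; foldr)
open import Data.List.Membership.Propositional using (_∈_)
import Data.List.Membership.Propositional.Properties as ∈
import Data.List.Properties as List
open import Data.List.Relation.Unary.All as All using (All; []; _∷_)
import Data.List.Relation.Unary.All.Properties as All
open import Data.List.Relation.Unary.AllPairs as AllPairs using (AllPairs; []; _∷_)
import Data.List.Relation.Unary.AllPairs.Properties as AllPairs
open import Data.List.Relation.Unary.Any using (here; there)
open import Data.List.Relation.Unary.Linked as Linked using (Linked; []; [-]; _∷_)
import Data.List.Relation.Unary.Linked.Properties as Linked
open import Data.Maybe using (Maybe; just; nothing)
import Data.Maybe.Properties as Maybe
open import Data.Nat using (zero; suc; _<_; _∸_; _<?_; z≤n; s≤s; ⌊_/2⌋)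
import Data.Nat as ℕ
open import Data.Nat.Divisibility using (_∣_; _∣0; ∣-refl; ∣-reflexive; ∣⇒≤; ∣m+n∣m⇒∣n; ∣m∸n∣n⇒∣m)
open import Data.Nat.Induction using (<-rec)
import Data.Nat.Properties as ℕ
open import Data.Product using (_×_; _,_; proj₁; proj₂; ∃-syntax)
open import Data.Rational using (0ℚ; ½)
import Data.Rational.Properties as Q
open import Data.Rational.Solver using (module +-*-Solver)
import Data.Rational.Unnormalised as ℚᵘ
import Data.Rational.Unnormalised.Properties as ℚᵘ
open import Data.Sum using (inj₁; inj₂)
open import Level using (0ℓ)
open import Relation.Binary.PropositionalEquality
open import Relation.Nullary using (yes; no; contradiction)
open import Relation.Unary using (Pred; Decidable)
open import Relation.Unary.Properties using (∁?)

open import Algebra.Properties.CommutativeSemiring.Exp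
  (CommutativeRing.commutativeSemiring Q.+-*-commutativeRing)
  using (_^_; ^-homo-*; ^-assocʳ; ^-distrib-*)

open +-*-Solver using (solve; _:=_; _:+_; _:-_; _:*_; con)

+-rotate : ∀ i a b → i ℕ.+ (a ℕ.+ b) ≡ i ℕ.+ b ℕ.+ a
+-rotate i a b = trans (cong (i ℕ.+_) (ℕ.+-comm a b)) (sym (ℕ.+-assoc i b a))

m+m≤n⇒m≤⌊n/2⌋ : ∀ {m n} → m ℕ.+ m ≤ n → m ≤ ⌊ n /2⌋
m+m≤n⇒m≤⌊n/2⌋ {m} m+m≤n = subst (_≤ _) (sym (ℕ.n≡⌊n+n/2⌋ m)) (ℕ.⌊n/2⌋-mono m+m≤n)

m≤⌊n/2⌋⇒m+m≤n : ∀ {m n} → m ≤ ⌊ n /2⌋ → m ℕ.+ m ≤ n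
m≤⌊n/2⌋⇒m+m≤n {m} {n} m≤⌊n/2⌋ = ℕ.≤-trans
  (ℕ.+-mono-≤ m≤⌊n/2⌋ (ℕ.≤-trans m≤⌊n/2⌋ (ℕ.⌊n/2⌋≤⌈n/2⌉ n)))
  (ℕ.≤-reflexive (ℕ.⌊n/2⌋+⌈n/2⌉≡n n))

m≤n+n⇒m∸n+[m∸n]≤m : ∀ {m n} → n ≤ m → m ≤ n ℕ.+ n → m ∸ n ℕ.+ (m ∸ n) ≤ m
m≤n+n⇒m∸n+[m∸n]≤m {m} {n} n≤m m≤n+n = ℕ.≤-trans
  (ℕ.+-monoʳ-≤ (m ∸ n) (ℕ.m≤n+o⇒m∸n≤o m n m≤n+n)) (ℕ.≤-reflexive (ℕ.m∸n+n≡m n≤m))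

sorted-multiples-bound : ∀ {d s N ps} → d ∣ s → s ≤ N → AllPairs _<_ ps →
  All (s <_) ps → All (d ∣_) ps → All (_≤ N) ps → s ℕ.+ length ps ℕ.* d ≤ N
sorted-multiples-bound {s = s} _ s≤N [] [] [] [] = ℕ.≤-trans (ℕ.≤-reflexive (ℕ.+-identityʳ s)) s≤N
sorted-multiples-bound {d} {s} {N} {p ∷ ps} d∣s _ (p<ps ∷ sorted) (s<p ∷ _) (d∣p ∷ d∣ps) (p≤N ∷ ps≤N) = begin
  s ℕ.+ (d ℕ.+ length ps ℕ.* d)  ≡⟨ ℕ.+-assoc s d _ ⟨
  s ℕ.+ d ℕ.+ length ps ℕ.* d    ≤⟨ ℕ.+-monoˡ-≤ (length ps ℕ.* d) s+d≤p ⟩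
  p ℕ.+ length ps ℕ.* d          ≤⟨ sorted-multiples-bound d∣p p≤N sorted p<ps d∣ps ps≤N ⟩
  N                              ∎
  where
  open ℕ.≤-Reasoning
  s≤p = ℕ.<⇒≤ s<p
  d∣p∸s : d ∣ p ∸ s
  d∣p∸s = ∣m+n∣m⇒∣n (subst (d ∣_) (sym (ℕ.m+[n∸m]≡n s≤p)) d∣p) d∣s
  s+d≤p : s ℕ.+ d ≤ p
  s+d≤p = subst (s ℕ.+ d ≤_) (ℕ.m+[n∸m]≡n s≤p)
    (ℕ.+-monoʳ-≤ s (∣⇒≤ {{ℕ.>-nonZero (ℕ.m<n⇒0<n∸m s<p)}} d∣p∸s))

length-take-≤ : ∀ {A : Set} {m} (x : List A) → m ≤ length x → length (take m x) ≡ m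
length-take-≤ {m = m} x m≤n = trans (List.length-take m x) (ℕ.m≤n⇒m⊓n≡m m≤n)

upTo-sorted : ∀ n → AllPairs _<_ (upTo n)
upTo-sorted n = AllPairs.applyUpTo⁺₁ (λ i → i) n (λ i<j _ → i<j)

all-map-suc-upTo-< : ∀ n → All (_< n) (map suc (upTo (n ∸ 1)))
all-map-suc-upTo-< zero    = []
all-map-suc-upTo-< (suc n) = All.map⁺ (All.map s≤s (All.all-upTo n))

head-minimal : ∀ {h t k} → AllPairs _<_ (h ∷ t) → k ∈ h ∷ t → h ≤ k
head-minimal _         (here refl)  = ℕ.≤-refl
head-minimal (h<t ∷ _) (there k∈t)  = ℕ.<⇒≤ (All.lookup h<t k∈t)

length-filter-∁ : ∀ {A : Set} {P : Pred A 0ℓ} (P? : Decidable P) xs →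
  length xs ≡ length (filter P? xs) ℕ.+ length (filter (∁? P?) xs)
length-filter-∁ P? [] = refl
length-filter-∁ P? (x ∷ xs) with P? x
... | yes _ = cong suc (length-filter-∁ P? xs)
... | no  _ = trans (cong suc (length-filter-∁ P? xs)) (sym (ℕ.+-suc _ _))

All∧AllPairs⇒Linked : ∀ {A : Set} {P : Pred A 0ℓ} {R S : A → A → Set} →
  (∀ {x y} → P x → P y → S x y → R x y) → ∀ {xs} → All P xs → AllPairs S xs → Linked R xs
All∧AllPairs⇒Linked step []               []                 = []
All∧AllPairs⇒Linked step (_ ∷ [])         (_ ∷ _)            = [-]
All∧AllPairs⇒Linked step (px ∷ py ∷ pxs) ((sxy ∷ _) ∷ sxs) =
  step px py sxy ∷ All∧AllPairs⇒Linked step (py ∷ pxs) sxs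

foldr-⊔-upper : ∀ {B : Set} (f : B → ℚ) {z m ms} → m ∈ ms → f m Q.≤ foldr (λ k r → f k Q.⊔ r) z ms
foldr-⊔-upper f {ms = k ∷ ms} (here refl) = Q.p≤p⊔q (f k) _
foldr-⊔-upper f {ms = k ∷ ms} (there m∈ms) = Q.≤-trans (foldr-⊔-upper f m∈ms) (Q.p≤q⊔p (f k) _)

-- Natural numbers as rationals

fromℕ : ℕ → ℚ
fromℕ n = + n / 1

private
  toℚᵘ-fromℕ : ∀ n → Q.toℚᵘ (fromℕ n) ℚᵘ.≃ (+ n ℚᵘ./ 1)
  toℚᵘ-fromℕ n = Q.toℚᵘ-fromℚᵘ (+ n ℚᵘ./ 1)

fromℕ-+ : ∀ m n → fromℕ (m ℕ.+ n) ≡ fromℕ m + fromℕ n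
fromℕ-+ m n = Q.toℚᵘ-injective (begin
    Q.toℚᵘ (fromℕ (m ℕ.+ n))               ≈⟨ toℚᵘ-fromℕ (m ℕ.+ n) ⟩
    + (m ℕ.+ n) ℚᵘ./ 1                      ≈⟨ ℚᵘ.*≡* (cong (ℤ._* + 1) eq) ⟩
    (+ m ℚᵘ./ 1) ℚᵘ.+ (+ n ℚᵘ./ 1)          ≈⟨ ℚᵘ.+-cong (toℚᵘ-fromℕ m) (toℚᵘ-fromℕ n) ⟨
    Q.toℚᵘ (fromℕ m) ℚᵘ.+ Q.toℚᵘ (fromℕ n) ≈⟨ Q.toℚᵘ-homo-+ (fromℕ m) (fromℕ n) ⟨
    Q.toℚᵘ (fromℕ m + fromℕ n)             ∎)
  where
  open ℚᵘ.≃-Reasoning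
  eq : + (m ℕ.+ n) ≡ + m ℤ.* + 1 ℤ.+ + n ℤ.* + 1
  eq rewrite ℤ.*-identityʳ (+ m) | ℤ.*-identityʳ (+ n) = ℤ.pos-+ m n

fromℕ-* : ∀ m n → fromℕ (m ℕ.* n) ≡ fromℕ m * fromℕ n
fromℕ-* m n = Q.toℚᵘ-injective (begin
    Q.toℚᵘ (fromℕ (m ℕ.* n))               ≈⟨ toℚᵘ-fromℕ (m ℕ.* n) ⟩
    + (m ℕ.* n) ℚᵘ./ 1                      ≈⟨ ℚᵘ.*≡* (cong (ℤ._* + 1) (ℤ.pos-* m n)) ⟩
    (+ m ℚᵘ./ 1) ℚᵘ.* (+ n ℚᵘ./ 1)          ≈⟨ ℚᵘ.*-cong (toℚᵘ-fromℕ m) (toℚᵘ-fromℕ n) ⟨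
    Q.toℚᵘ (fromℕ m) ℚᵘ.* Q.toℚᵘ (fromℕ n) ≈⟨ Q.toℚᵘ-homo-* (fromℕ m) (fromℕ n) ⟨
    Q.toℚᵘ (fromℕ m * fromℕ n)             ∎)
  where open ℚᵘ.≃-Reasoning

fromℕ-mono-≤ : ∀ {m n} → m ≤ n → fromℕ m Q.≤ fromℕ n
fromℕ-mono-≤ {m} {n} m≤n = Q.toℚᵘ-cancel-≤ (begin
    Q.toℚᵘ (fromℕ m) ≃⟨ toℚᵘ-fromℕ m ⟩
    + m ℚᵘ./ 1       ≤⟨ ℚᵘ.*≤* (ℤ.*-monoʳ-≤-nonNeg (+ 1) (ℤ.+≤+ m≤n)) ⟩
    + n ℚᵘ./ 1       ≃⟨ toℚᵘ-fromℕ n ⟨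
    Q.toℚᵘ (fromℕ n) ∎)
  where open ℚᵘ.≤-Reasoning

fromℕ-cancel-≤ : ∀ {m n} → fromℕ m Q.≤ fromℕ n → m ≤ n
fromℕ-cancel-≤ {m} {n} le
  with ℚᵘ.drop-*≤* (ℚᵘ.≤-respʳ-≃ (toℚᵘ-fromℕ n) (ℚᵘ.≤-respˡ-≃ (toℚᵘ-fromℕ m) (Q.toℚᵘ-mono-≤ le)))
... | le′ rewrite ℤ.*-identityʳ (+ m) | ℤ.*-identityʳ (+ n) = ℤ.drop‿+≤+ le′

/-*-fromℕ : ∀ a b .{{_ : NonZero b}} → (+ a / b) * fromℕ b ≡ fromℕ a
/-*-fromℕ a (suc b) = Q.toℚᵘ-injective (begin
    Q.toℚᵘ (+ a / suc b * fromℕ (suc b))              ≈⟨ Q.toℚᵘ-homo-* (+ a / suc b) (fromℕ (suc b)) ⟩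
    Q.toℚᵘ (+ a / suc b) ℚᵘ.* Q.toℚᵘ (fromℕ (suc b)) ≈⟨ ℚᵘ.*-cong (Q.toℚᵘ-fromℚᵘ (+ a ℚᵘ./ suc b)) (toℚᵘ-fromℕ (suc b)) ⟩
    (+ a ℚᵘ./ suc b) ℚᵘ.* (+ suc b ℚᵘ./ 1)           ≈⟨ ℚᵘ.*≡* eq ⟩
    + a ℚᵘ./ 1                                        ≈⟨ toℚᵘ-fromℕ a ⟨
    Q.toℚᵘ (fromℕ a)                                  ∎)
  where
  open ℚᵘ.≃-Reasoning
  eq : + a ℤ.* + suc b ℤ.* + 1 ≡ + a ℤ.* + (suc b ℕ.* 1)
  eq rewrite ℕ.*-identityʳ (suc b) = ℤ.*-identityʳ _

*-monoˡ-≤ : ∀ {r p q} → 0ℚ Q.≤ r → p Q.≤ q → r * p Q.≤ r * q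
*-monoˡ-≤ {r} 0≤r = Q.*-monoˡ-≤-nonNeg r {{Q.nonNegative 0≤r}}

*-monoʳ-≤ : ∀ {r p q} → 0ℚ Q.≤ r → p Q.≤ q → p * r Q.≤ q * r
*-monoʳ-≤ {r} 0≤r = Q.*-monoʳ-≤-nonNeg r {{Q.nonNegative 0≤r}}

*-nonNeg : ∀ {p q} → 0ℚ Q.≤ p → 0ℚ Q.≤ q → 0ℚ Q.≤ p * q
*-nonNeg {p} {q} 0≤p 0≤q = Q.nonNegative⁻¹ (p * q)
  {{Q.nonNeg*nonNeg⇒nonNeg p {{Q.nonNegative 0≤p}} q {{Q.nonNegative 0≤q}}}}

fromℕ-nonNeg : ∀ n → 0ℚ Q.≤ fromℕ n
fromℕ-nonNeg n = fromℕ-mono-≤ {0} {n} z≤n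

/-nonNeg : ∀ a b .{{_ : NonZero b}} → 0ℚ Q.≤ + a / b
/-nonNeg a b = Q.nonNegative⁻¹ _ {{Q.normalize-nonNeg a b}}

/≤⇒≤*fromℕ : ∀ a b {q} .{{_ : NonZero b}} → + a / b Q.≤ q → fromℕ a Q.≤ q * fromℕ b
/≤⇒≤*fromℕ a b {q} a/b≤q = begin
  fromℕ a            ≡⟨ /-*-fromℕ a b ⟨
  + a / b * fromℕ b  ≤⟨ *-monoʳ-≤ (fromℕ-nonNeg b) a/b≤q ⟩
  q * fromℕ b        ∎
  where open Q.≤-Reasoning

-- Powers

^ℚ≡^ : ∀ p n → p ^ℚ n ≡ p ^ n
^ℚ≡^ p zero    = refl
^ℚ≡^ p (suc n) = cong (p *_) (^ℚ≡^ p n)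

^-nonNeg : ∀ n {p} → 0ℚ Q.≤ p → 0ℚ Q.≤ p ^ n
^-nonNeg zero    _   = fromℕ-nonNeg 1
^-nonNeg (suc n) 0≤p = *-nonNeg 0≤p (^-nonNeg n 0≤p)

^-pos : ∀ n {p} → 0ℚ Q.< p → 0ℚ Q.< p ^ n
^-pos zero    _   = Q.*<* (ℤ.+<+ (s≤s z≤n))
^-pos (suc n) {p} 0<p = Q.positive⁻¹ (p * p ^ n)
  {{Q.pos*pos⇒pos p {{Q.positive 0<p}} (p ^ n) {{Q.positive (^-pos n 0<p)}}}}

^-mono-≤ : ∀ n {p q} → 0ℚ Q.≤ p → p Q.≤ q → p ^ n Q.≤ q ^ n
^-mono-≤ zero    _   _   = Q.≤-refl
^-mono-≤ (suc n) {p} {q} 0≤p p≤q = begin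
  p * p ^ n  ≤⟨ *-monoˡ-≤ 0≤p (^-mono-≤ n 0≤p p≤q) ⟩
  p * q ^ n  ≤⟨ *-monoʳ-≤ (^-nonNeg n (Q.≤-trans 0≤p p≤q)) p≤q ⟩
  q * q ^ n  ∎
  where open Q.≤-Reasoning

*^-split : ∀ p q c b a r → c ℕ.* b ≡ a ℕ.+ r → (p * q ^ c) ^ b ≡ p ^ b * q ^ a * q ^ r
*^-split p q c b a r cb≡a+r = begin
  (p * q ^ c) ^ b          ≡⟨ ^-distrib-* p (q ^ c) b ⟩
  p ^ b * (q ^ c) ^ b      ≡⟨ cong (p ^ b *_) (^-assocʳ q c b) ⟩
  p ^ b * q ^ (c ℕ.* b)    ≡⟨ cong (λ k → p ^ b * q ^ k) cb≡a+r ⟩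
  p ^ b * q ^ (a ℕ.+ r)    ≡⟨ cong (p ^ b *_) (^-homo-* q a r) ⟩
  p ^ b * (q ^ a * q ^ r)  ≡⟨ Q.*-assoc (p ^ b) (q ^ a) (q ^ r) ⟨
  p ^ b * q ^ a * q ^ r    ∎
  where open ≡-Reasoning

geometric-decay : ∀ {e d} → 0ℚ Q.≤ e → 0ℚ Q.≤ d → ∀ {y ys} →
  Linked (λ u v → e * v Q.≤ d * u) (y ∷ ys) → All (1ℚ Q.≤_) (y ∷ ys) →
  e ^ length ys Q.≤ d ^ length ys * y
geometric-decay _ _ {y} [-] (1≤y ∷ []) =
  Q.≤-trans 1≤y (Q.≤-reflexive (sym (Q.*-identityˡ y)))
geometric-decay {e} {d} 0≤e 0≤d {y} {z ∷ zs} (ez≤dy ∷ linked) (_ ∷ 1≤zs) = begin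
  e * e ^ k        ≤⟨ *-monoˡ-≤ 0≤e (geometric-decay 0≤e 0≤d linked 1≤zs) ⟩
  e * (d ^ k * z)  ≡⟨ solve 3 (λ e D z → e :* (D :* z) := D :* (e :* z)) refl e (d ^ k) z ⟩
  d ^ k * (e * z)  ≤⟨ *-monoˡ-≤ (^-nonNeg k 0≤d) ez≤dy ⟩
  d ^ k * (d * y)  ≡⟨ solve 3 (λ d D y → D :* (d :* y) := d :* D :* y) refl d (d ^ k) y ⟩
  d * d ^ k * y    ∎
  where
  open Q.≤-Reasoning
  k = length zs

contracting-step : ∀ {e a b c} → c ≡ a + b → c Q.≤ e * b → e * a Q.≤ (e - 1ℚ) * c
contracting-step {e} {a} {b} refl a+b≤eb = begin
  e * a                      ≡⟨ solve 3 (λ e a b → e :* a := e :* a :+ (a :+ b) :- (a :+ b)) refl e a b ⟩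
  e * a + (a + b) - (a + b)  ≤⟨ Q.+-monoˡ-≤ (Q.- (a + b)) (Q.+-monoʳ-≤ (e * a) a+b≤eb) ⟩
  e * a + e * b - (a + b)    ≡⟨ solve 3 (λ e a b → e :* a :+ e :* b :- (a :+ b) := (e :- con 1ℚ) :* (a :+ b)) refl e a b ⟩
  (e - 1ℚ) * (a + b)         ∎
  where open Q.≤-Reasoning

power-bound : ∀ {e} n c a b .{{_ : NonZero b}} → 1ℚ Q.< e →
  fromℕ 2 * e ^ c Q.≤ fromℕ n * (e - 1ℚ) ^ c → + a / b Q.≤ fromℕ c →
  e ^ℚ a * fromℕ 2 ^ℚ b Q.≤ fromℕ n ^ℚ b * (e - 1ℚ) ^ℚ a
power-bound {e} n c a b 1<e 2eᶜ≤ndᶜ a/b≤c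
  rewrite ^ℚ≡^ e a | ^ℚ≡^ (fromℕ 2) b | ^ℚ≡^ (fromℕ n) b | ^ℚ≡^ (e - 1ℚ) a =
  Q.*-cancelʳ-≤-pos (e ^ r) {{Q.positive (^-pos r 0<e)}} (begin
    e ^ a * fromℕ 2 ^ b * e ^ r    ≡⟨ cong (_* e ^ r) (Q.*-comm (e ^ a) (fromℕ 2 ^ b)) ⟩
    fromℕ 2 ^ b * e ^ a * e ^ r    ≡⟨ *^-split (fromℕ 2) e c b a r cb≡a+r ⟨
    (fromℕ 2 * e ^ c) ^ b          ≤⟨ ^-mono-≤ b (*-nonNeg (fromℕ-nonNeg 2) (^-nonNeg c 0≤e)) 2eᶜ≤ndᶜ ⟩
    (fromℕ n * d ^ c) ^ b          ≡⟨ *^-split (fromℕ n) d c b a r cb≡a+r ⟩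
    fromℕ n ^ b * d ^ a * d ^ r    ≤⟨ *-monoˡ-≤ (*-nonNeg (^-nonNeg b (fromℕ-nonNeg n)) (^-nonNeg a 0≤d)) (^-mono-≤ r 0≤d d≤e) ⟩
    fromℕ n ^ b * d ^ a * e ^ r    ∎)
  where
  open Q.≤-Reasoning
  d = e - 1ℚ
  0<d : 0ℚ Q.< d
  0<d = Q.+-monoˡ-< (Q.- 1ℚ) 1<e
  0≤d = Q.<⇒≤ 0<d
  d≤e : d Q.≤ e
  d≤e = Q.≤-trans (Q.+-monoʳ-≤ e (Q.*≤* ℤ.-≤+)) (Q.≤-reflexive (Q.+-identityʳ e))
  0<e = Q.<-≤-trans 0<d d≤e
  0≤e = Q.<⇒≤ 0<e
  a≤cb : a ≤ c ℕ.* b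
  a≤cb = fromℕ-cancel-≤ (Q.≤-trans (/≤⇒≤*fromℕ a b a/b≤c) (Q.≤-reflexive (sym (fromℕ-* c b))))
  r = c ℕ.* b ∸ a
  cb≡a+r : c ℕ.* b ≡ a ℕ.+ r
  cb≡a+r = sym (ℕ.m+[n∸m]≡n a≤cb)

-- Periods of words

module _ {A : Set} where

  _‼_ : List A → ℕ → Maybe A
  []      ‼ _     = nothing
  (a ∷ _) ‼ zero  = just a
  (_ ∷ x) ‼ suc i = x ‼ i

  ‼-toℕ : ∀ x (i : Fin (length x)) → x ‼ toℕ i ≡ just (lookup x i)
  ‼-toℕ (_ ∷ _) Fin.zero    = refl
  ‼-toℕ (_ ∷ x) (Fin.suc i) = ‼-toℕ x i

  ‼-take : ∀ x {m i} → i < m → take m x ‼ i ≡ x ‼ i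
  ‼-take []      {suc _}         _         = refl
  ‼-take (_ ∷ _) {suc _} {zero}  _         = refl
  ‼-take (_ ∷ x) {suc _} {suc _} (s≤s i<m) = ‼-take x i<m

  ‼-++ˡ : ∀ w {u i} → i < length w → (w ++ u) ‼ i ≡ w ‼ i
  ‼-++ˡ (_ ∷ _) {i = zero}  _         = refl
  ‼-++ˡ (_ ∷ w) {i = suc _} (s≤s i<w) = ‼-++ˡ w i<w

  ‼-++ʳ : ∀ v {w} i → (v ++ w) ‼ (length v ℕ.+ i) ≡ w ‼ i
  ‼-++ʳ []      i = refl
  ‼-++ʳ (_ ∷ v) i = ‼-++ʳ v i

  Periodic : List A → ℕ → Set
  Periodic x p = ∀ i → i ℕ.+ p < length x → x ‼ i ≡ x ‼ (i ℕ.+ p)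

  periodic-difference : ∀ x {q r} → Periodic x q → Periodic x (q ℕ.+ r) →
    q ℕ.+ r ℕ.+ q ≤ length x → Periodic x r
  -- Either step forward by q + r and back by q, or, if that leaves x, back by q and
  -- forward by q + r; the length bound guarantees one of the two stays inside x.
  periodic-difference x {q} {r} per-q per-q+r q+r+q≤n i i+r<n
    with i ℕ.+ (q ℕ.+ r) <? length x
  ... | yes i+[q+r]<n = begin
    x ‼ i                  ≡⟨ per-q+r i i+[q+r]<n ⟩
    x ‼ (i ℕ.+ (q ℕ.+ r))  ≡⟨ cong (x ‼_) (+-rotate i q r) ⟩
    x ‼ (i ℕ.+ r ℕ.+ q)    ≡⟨ per-q (i ℕ.+ r) (subst (_< length x) (+-rotate i q r) i+[q+r]<n) ⟨
    x ‼ (i ℕ.+ r)          ∎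
    where open ≡-Reasoning
  ... | no i+[q+r]≮n = begin
    x ‼ i                  ≡⟨ cong (x ‼_) j+q≡i ⟨
    x ‼ (j ℕ.+ q)          ≡⟨ per-q j (subst (_< length x) (sym j+q≡i) (ℕ.≤-<-trans (ℕ.m≤m+n i r) i+r<n)) ⟨
    x ‼ j                  ≡⟨ per-q+r j (subst (_< length x) (sym j+[q+r]≡i+r) i+r<n) ⟩
    x ‼ (j ℕ.+ (q ℕ.+ r))  ≡⟨ cong (x ‼_) j+[q+r]≡i+r ⟩
    x ‼ (i ℕ.+ r)          ∎
    where
    open ≡-Reasoning
    q≤i : q ≤ i
    q≤i = ℕ.+-cancelʳ-≤ (q ℕ.+ r) q i (subst (_≤ i ℕ.+ (q ℕ.+ r)) (ℕ.+-comm (q ℕ.+ r) q)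
      (ℕ.≤-trans q+r+q≤n (ℕ.≮⇒≥ i+[q+r]≮n)))
    j = i ∸ q
    j+q≡i : j ℕ.+ q ≡ i
    j+q≡i = ℕ.m∸n+n≡m q≤i
    j+[q+r]≡i+r : j ℕ.+ (q ℕ.+ r) ≡ i ℕ.+ r
    j+[q+r]≡i+r = trans (sym (ℕ.+-assoc j q r)) (cong (ℕ._+ r) j+q≡i)

  periodic-take : ∀ x {p d m} → m ℕ.+ p ≤ length x → Periodic x p → Periodic x (p ℕ.+ d) →
    Periodic (take m x) d
  periodic-take x {p} {d} {m} m+p≤n per-p per-p+d i i+d<|w| = begin
    take m x ‼ i           ≡⟨ ‼-take x (ℕ.≤-<-trans (ℕ.m≤m+n i d) i+d<m) ⟩
    x ‼ i                  ≡⟨ per-p+d i (subst (_< length x) (sym (+-rotate i p d)) i+d+p<n) ⟩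
    x ‼ (i ℕ.+ (p ℕ.+ d))  ≡⟨ cong (x ‼_) (+-rotate i p d) ⟩
    x ‼ (i ℕ.+ d ℕ.+ p)    ≡⟨ per-p (i ℕ.+ d) i+d+p<n ⟨
    x ‼ (i ℕ.+ d)          ≡⟨ ‼-take x i+d<m ⟨
    take m x ‼ (i ℕ.+ d)   ∎
    where
    open ≡-Reasoning
    i+d<m : i ℕ.+ d < m
    i+d<m = subst (i ℕ.+ d <_) (length-take-≤ x (ℕ.≤-trans (ℕ.m≤m+n m p) m+p≤n)) i+d<|w|
    i+d+p<n : i ℕ.+ d ℕ.+ p < length x
    i+d+p<n = ℕ.<-≤-trans (ℕ.+-monoˡ-< p i+d<m) m+p≤n

  border-periodic : ∀ {x v w u} → x ≡ v ++ w → x ≡ w ++ u → Periodic x (length v)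
  border-periodic {v = v} {w} {u} refl v++w≡w++u i i+|v|<n = begin
    (v ++ w) ‼ i                 ≡⟨ cong (_‼ i) v++w≡w++u ⟩
    (w ++ u) ‼ i                 ≡⟨ ‼-++ˡ w i<|w| ⟩
    w ‼ i                        ≡⟨ ‼-++ʳ v i ⟨
    (v ++ w) ‼ (length v ℕ.+ i)  ≡⟨ cong ((v ++ w) ‼_) (ℕ.+-comm (length v) i) ⟩
    (v ++ w) ‼ (i ℕ.+ length v)  ∎
    where
    open ≡-Reasoning
    i<|w| : i < length w
    i<|w| = ℕ.+-cancelˡ-< (length v) i (length w)
      (subst₂ _<_ (ℕ.+-comm i (length v)) (List.length-++ v) i+|v|<n)

module _ {A : Set} (_≟_ : DecidableEquality A) where

  IsPeriod⇒Periodic : ∀ x {p} → IsPeriod _≟_ x p → Periodic x p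
  IsPeriod⇒Periodic x {p} (_ , _ , period) i i+p<n = begin
    x ‼ i                          ≡⟨ cong (x ‼_) (Fin.toℕ-fromℕ< i<n) ⟨
    x ‼ toℕ (Fin.fromℕ< i<n)       ≡⟨ ‼-toℕ x _ ⟩
    just (lookup x (Fin.fromℕ< i<n))   ≡⟨ cong just (period _ _ j≡i+p) ⟩
    just (lookup x (Fin.fromℕ< i+p<n)) ≡⟨ ‼-toℕ x _ ⟨
    x ‼ toℕ (Fin.fromℕ< i+p<n)     ≡⟨ cong (x ‼_) (Fin.toℕ-fromℕ< i+p<n) ⟩
    x ‼ (i ℕ.+ p)                  ∎
    where
    open ≡-Reasoning
    i<n = ℕ.≤-<-trans (ℕ.m≤m+n i p) i+p<n
    j≡i+p : toℕ (Fin.fromℕ< i+p<n) ≡ toℕ (Fin.fromℕ< i<n) ℕ.+ p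
    j≡i+p = trans (Fin.toℕ-fromℕ< i+p<n) (cong (ℕ._+ p) (sym (Fin.toℕ-fromℕ< i<n)))

  Periodic⇒IsPeriod : ∀ x {p} → 1 ≤ p → p ≤ length x → Periodic x p → IsPeriod _≟_ x p
  Periodic⇒IsPeriod x {p} 1≤p p≤n periodic = 1≤p , p≤n , λ i j j≡i+p → Maybe.just-injective (begin
    just (lookup x i)  ≡⟨ ‼-toℕ x i ⟨
    x ‼ toℕ i          ≡⟨ periodic (toℕ i) (subst (_< length x) j≡i+p (Fin.toℕ<n j)) ⟩
    x ‼ (toℕ i ℕ.+ p)  ≡⟨ cong (x ‼_) j≡i+p ⟨
    x ‼ toℕ j          ≡⟨ ‼-toℕ x j ⟩
    just (lookup x j)  ∎)
    where open ≡-Reasoning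

  length-isPeriod : ∀ x → 1 ≤ length x → IsPeriod _≟_ x (length x)
  length-isPeriod x 1≤n = Periodic⇒IsPeriod x 1≤n ℕ.≤-refl (λ i i+n<n → contradiction i+n<n (ℕ.m+n≮n i _))

  private
    period-index : ∀ x {d} → IsPeriod _≟_ x (suc d) →
      d ∈ filter (λ k → isPeriod? _≟_ x (suc k)) (upTo (length x))
    period-index x isPer@(_ , sd≤n , _) =
      ∈.∈-filter⁺ (λ k → isPeriod? _≟_ x (suc k)) (∈.∈-upTo⁺ sd≤n) isPer

  per-minimal : ∀ x {p} → IsPeriod _≟_ x p → per _≟_ x ≤ p
  per-minimal x {suc d} isPer with filter (λ k → isPeriod? _≟_ x (suc k)) (upTo (length x)) in eq
  ... | []    = contradiction (subst (d ∈_) eq (period-index x isPer)) λ ()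
  ... | h ∷ t = s≤s (head-minimal (subst (AllPairs _<_) eq (AllPairs.filter⁺ _ (upTo-sorted (length x))))
                                  (subst (d ∈_) eq (period-index x isPer)))

  per-isPeriod : ∀ x → 1 ≤ length x → IsPeriod _≟_ x (per _≟_ x)
  per-isPeriod x 1≤n with filter (λ k → isPeriod? _≟_ x (suc k)) (upTo (length x)) in eq
  ... | []    = contradiction (subst (_ ∈_) eq (period-index x trivial)) λ ()
    where
    trivial : IsPeriod _≟_ x (suc (length x ∸ 1))
    trivial = subst (IsPeriod _≟_ x) (sym (ℕ.suc-pred (length x) {{ℕ.>-nonZero 1≤n}})) (length-isPeriod x 1≤n)
  ... | h ∷ t = proj₂ (∈.∈-filter⁻ (λ k → isPeriod? _≟_ x (suc k)) {xs = upTo (length x)}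
                                   (subst (h ∈_) (sym eq) (here refl)))

  per∣short-period : ∀ x {p} → IsPeriod _≟_ x p → p ℕ.+ p ≤ length x → per _≟_ x ∣ p
  per∣short-period x {p} = <-rec (λ p → IsPeriod _≟_ x p → p ℕ.+ p ≤ length x → π ∣ p) step p
    where
    π = per _≟_ x
    step : ∀ p → (∀ {q} → q < p → IsPeriod _≟_ x q → q ℕ.+ q ≤ length x → π ∣ q) →
           IsPeriod _≟_ x p → p ℕ.+ p ≤ length x → π ∣ p
    step p rec isPer@(1≤p , p≤n , _) p+p≤n with ℕ.m≤n⇒m<n∨m≡n (per-minimal x isPer)
    ... | inj₂ π≡p = ∣-reflexive π≡p
    ... | inj₁ π<p = ∣m∸n∣n⇒∣m π π≤p (rec r<p r-isPeriod r+r≤n) ∣-refl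
      where
      π≤p = ℕ.<⇒≤ π<p
      r = p ∸ π
      r≤p = ℕ.m∸n≤m p π
      r<p : r < p
      r<p = ℕ.∸-monoʳ-< ℕ.z<s π≤p
      π+r≡p : π ℕ.+ r ≡ p
      π+r≡p = ℕ.m+[n∸m]≡n π≤p
      π+r+π≤n : π ℕ.+ r ℕ.+ π ≤ length x
      π+r+π≤n = subst (λ k → k ℕ.+ π ≤ length x) (sym π+r≡p) (ℕ.≤-trans (ℕ.+-monoʳ-≤ p π≤p) p+p≤n)
      r-isPeriod : IsPeriod _≟_ x r
      r-isPeriod = Periodic⇒IsPeriod x (ℕ.m<n⇒0<n∸m π<p) (ℕ.≤-trans r≤p p≤n)
        (periodic-difference x (IsPeriod⇒Periodic x (per-isPeriod x (ℕ.≤-trans 1≤p p≤n)))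
                             (subst (Periodic x) (sym π+r≡p) (IsPeriod⇒Periodic x isPer)) π+r+π≤n)
      r+r≤n = ℕ.≤-trans (ℕ.+-mono-≤ r≤p r≤p) p+p≤n

  per<length : ∀ x → Bordered _≟_ x → per _≟_ x < length x
  per<length x (w , 0<|w| , |w|<n , (u , x≡w++u) , (v , x≡v++w)) =
    ℕ.≤-<-trans (per-minimal x (Periodic⇒IsPeriod x 1≤|v| (ℕ.<⇒≤ |v|<n) (border-periodic {v = v} {w} {u} x≡v++w x≡w++u))) |v|<n
    where
    n≡|v|+|w| : length x ≡ length v ℕ.+ length w
    n≡|v|+|w| = trans (cong length x≡v++w) (List.length-++ v)
    |v|<n : length v < length x
    |v|<n = subst (length v <_) (sym n≡|v|+|w|) (ℕ.m<m+n (length v) 0<|w|)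
    1≤|v| : 1 ≤ length v
    1≤|v| = ℕ.+-cancelʳ-< (length w) 0 (length v) (subst (length w <_) n≡|v|+|w| |w|<n)

  module _ (x : List A) where

    private
      n = length x
      e = ice _≟_ x
      periods = filter (isPeriod? _≟_ x) (map suc (upTo (n ∸ 1)))
      short? : Decidable (λ p → p ℕ.+ p ≤ n)
      short? p = p ℕ.+ p ℕ.≤? n
      shorts = filter short? periods
      longs = filter (∁? short?) periods
      periods-sorted : AllPairs _<_ periods
      periods-sorted = AllPairs.filter⁺ _ (AllPairs.map⁺ (AllPairs.map s≤s (upTo-sorted (n ∸ 1))))
      periods-nontrivial : All (λ p → IsPeriod _≟_ x p × p < n) periods
      periods-nontrivial = All.zip (All.all-filter (isPeriod? _≟_ x) (map suc (upTo (n ∸ 1))) ,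
                                    All.filter⁺ (isPeriod? _≟_ x) (all-map-suc-upTo-< n))

    length≤ice*period : ∀ {m d} → 1 ≤ m → m ≤ n → IsPeriod _≟_ (take m x) d → fromℕ m Q.≤ e * fromℕ d
    length≤ice*period {suc k} {d} _ m≤n isPer = begin
      fromℕ m            ≡⟨ /-*-fromℕ m π ⟨
      + m / π * fromℕ π  ≤⟨ *-monoˡ-≤ (/-nonNeg m π) (fromℕ-mono-≤ (per-minimal w isPer)) ⟩
      + m / π * fromℕ d  ≤⟨ *-monoʳ-≤ (fromℕ-nonNeg d) exp≤ice ⟩
      e * fromℕ d        ∎
      where
      open Q.≤-Reasoning
      m = suc k
      w = take m x
      π = per _≟_ w
      exp≤ice : + m / π Q.≤ e
      exp≤ice = subst (λ l → + l / π Q.≤ e) (length-take-≤ x m≤n)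
        (foldr-⊔-upper (λ m → exp _≟_ (take m x)) (∈.∈-map⁺ suc (∈.∈-upTo⁺ m≤n)))

    length≤ice*per : 1 ≤ n → fromℕ n Q.≤ e * fromℕ (per _≟_ x)
    length≤ice*per 1≤n = length≤ice*period 1≤n ℕ.≤-refl
      (subst (λ w → IsPeriod _≟_ w (per _≟_ x)) (sym (List.take-all n x ℕ.≤-refl)) (per-isPeriod x 1≤n))

    1<ice : Bordered _≟_ x → 1ℚ Q.< e
    1<ice bordered = Q.≰⇒> λ e≤1 → ℕ.<⇒≱ π<n (fromℕ-cancel-≤ (begin
      fromℕ n          ≤⟨ length≤ice*per 1≤n ⟩
      e * fromℕ π      ≤⟨ *-monoʳ-≤ (fromℕ-nonNeg π) e≤1 ⟩
      1ℚ * fromℕ π     ≡⟨ Q.*-identityˡ (fromℕ π) ⟩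
      fromℕ π          ∎))
      where
      open Q.≤-Reasoning
      π = per _≟_ x
      π<n = per<length x bordered
      1≤n = ℕ.≤-trans (s≤s z≤n) π<n

    period-gap : ∀ {p q} → IsPeriod _≟_ x p → IsPeriod _≟_ x q → p < q →
      fromℕ (n ∸ p) Q.≤ e * fromℕ (q ∸ p)
    period-gap {p} {q} isPer-p isPer-q@(_ , q≤n , _) p<q =
      length≤ice*period (ℕ.m<n⇒0<n∸m p<n) (ℕ.m∸n≤m n p)
        (Periodic⇒IsPeriod (take (n ∸ p) x) (ℕ.m<n⇒0<n∸m p<q) d≤|w|
          (periodic-take x (ℕ.≤-reflexive (ℕ.m∸n+n≡m (ℕ.<⇒≤ p<n))) (IsPeriod⇒Periodic x isPer-p)
            (subst (Periodic x) (sym (ℕ.m+[n∸m]≡n (ℕ.<⇒≤ p<q))) (IsPeriod⇒Periodic x isPer-q))))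
      where
      p<n = ℕ.<-≤-trans p<q q≤n
      d≤|w| : q ∸ p ≤ length (take (n ∸ p) x)
      d≤|w| = subst (q ∸ p ≤_) (sym (length-take-≤ x (ℕ.m∸n≤m n p))) (ℕ.∸-monoˡ-≤ p q≤n)

    short-periods-bound : ∀ {ps} → 1 ≤ n → AllPairs _<_ ps →
      All (λ p → IsPeriod _≟_ x p × p ℕ.+ p ≤ n) ps → fromℕ (length ps) Q.≤ e * ½
    short-periods-bound {ps} 1≤n sorted shorts = begin
      fromℕ c                      ≡⟨ solve 1 (λ c → c := (c :+ c) :* con ½) refl (fromℕ c) ⟩
      (fromℕ c + fromℕ c) * ½      ≤⟨ *-monoʳ-≤ (/-nonNeg 1 2) 2c≤e ⟩
      e * ½                        ∎
      where
      open Q.≤-Reasoning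
      c = length ps
      π = per _≟_ x
      cπ≤⌊n/2⌋ : 0 ℕ.+ c ℕ.* π ≤ ⌊ n /2⌋
      cπ≤⌊n/2⌋ = sorted-multiples-bound (π ∣0) z≤n sorted
        (All.map (λ (isPer , _) → proj₁ isPer) shorts)
        (All.map (λ (isPer , short) → per∣short-period x isPer short) shorts)
        (All.map (λ (_ , short) → m+m≤n⇒m≤⌊n/2⌋ short) shorts)
      [c+c]π≤n : (c ℕ.+ c) ℕ.* π ≤ n
      [c+c]π≤n = subst (_≤ n) (sym (ℕ.*-distribʳ-+ π c c)) (m≤⌊n/2⌋⇒m+m≤n cπ≤⌊n/2⌋)
      2c≤e : fromℕ c + fromℕ c Q.≤ e
      2c≤e = Q.*-cancelʳ-≤-pos (fromℕ π) {{Q.normalize-pos π 1}} (begin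
        (fromℕ c + fromℕ c) * fromℕ π  ≡⟨ cong (_* fromℕ π) (fromℕ-+ c c) ⟨
        fromℕ (c ℕ.+ c) * fromℕ π      ≡⟨ fromℕ-* (c ℕ.+ c) π ⟨
        fromℕ ((c ℕ.+ c) ℕ.* π)        ≤⟨ fromℕ-mono-≤ [c+c]π≤n ⟩
        fromℕ n                        ≤⟨ length≤ice*per 1≤n ⟩
        e * fromℕ π                    ∎)

    long-periods-decay : ∀ {p ps} → 1ℚ Q.< e → AllPairs _<_ (p ∷ ps) →
      All (λ q → IsPeriod _≟_ x q × q < n) (p ∷ ps) → n < p ℕ.+ p →
      fromℕ 2 * e ^ length ps Q.≤ fromℕ n * (e - 1ℚ) ^ length ps
    long-periods-decay {p} {ps} 1<e sorted periods n<p+p = begin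
      fromℕ 2 * e ^ k                  ≤⟨ *-monoˡ-≤ (fromℕ-nonNeg 2) decay ⟩
      fromℕ 2 * (d ^ k * f p)          ≡⟨ solve 2 (λ D F → con (fromℕ 2) :* (D :* F) := (F :+ F) :* D) refl (d ^ k) (f p) ⟩
      (f p + f p) * d ^ k              ≡⟨ cong (_* d ^ k) (fromℕ-+ (n ∸ p) (n ∸ p)) ⟨
      fromℕ (n ∸ p ℕ.+ (n ∸ p)) * d ^ k ≤⟨ *-monoʳ-≤ (^-nonNeg k 0≤d) (fromℕ-mono-≤ (m≤n+n⇒m∸n+[m∸n]≤m p≤n (ℕ.<⇒≤ n<p+p))) ⟩
      fromℕ n * d ^ k                  ∎
      where
      open Q.≤-Reasoning
      k = length ps
      d = e - 1ℚ
      f : ℕ → ℚ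
      f q = fromℕ (n ∸ q)
      0≤d : 0ℚ Q.≤ d
      0≤d = Q.<⇒≤ (Q.+-monoˡ-< (Q.- 1ℚ) 1<e)
      0≤e = Q.≤-trans (fromℕ-nonNeg 1) (Q.<⇒≤ 1<e)
      contracts : ∀ {q q′} → IsPeriod _≟_ x q × q < n → IsPeriod _≟_ x q′ × q′ < n → q < q′ →
        e * f q′ Q.≤ d * f q
      contracts {q} {q′} (isPer-q , _) (isPer-q′ , q′<n) q<q′ =
        contracting-step {e} {f q′} (trans (cong fromℕ n∸q≡) (fromℕ-+ (n ∸ q′) (q′ ∸ q))) (period-gap isPer-q isPer-q′ q<q′)
        where
        n∸q≡ : n ∸ q ≡ n ∸ q′ ℕ.+ (q′ ∸ q)
        n∸q≡ = trans (cong (_∸ q) (sym (ℕ.m∸n+n≡m (ℕ.<⇒≤ q′<n)))) (ℕ.+-∸-assoc (n ∸ q′) (ℕ.<⇒≤ q<q′))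
      decay : e ^ k Q.≤ d ^ k * f p
      decay = subst (λ j → e ^ j Q.≤ d ^ j * f p) (List.length-map f ps)
        (geometric-decay 0≤e 0≤d (Linked.map⁺ (All∧AllPairs⇒Linked contracts periods sorted))
          (All.map⁺ (All.map (λ (_ , q<n) → fromℕ-mono-≤ (ℕ.m<n⇒0<n∸m q<n)) periods)))
      p≤n = ℕ.<⇒≤ (proj₂ (All.head periods))

    long-periods-count : 1ℚ Q.< e → 2 ≤ n → ∀ {ls} → AllPairs _<_ ls →
      All (λ q → (IsPeriod _≟_ x q × q < n) × n < q ℕ.+ q) ls →
      ∃[ c ] length ls ≤ suc c × fromℕ 2 * e ^ c Q.≤ fromℕ n * (e - 1ℚ) ^ c
    long-periods-count _ 2≤n {[]} _ _ = 0 , z≤n , *-monoʳ-≤ (fromℕ-nonNeg 1) (fromℕ-mono-≤ 2≤n)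
    long-periods-count 1<e _ {_ ∷ ps} sorted longs@((_ , n<p+p) ∷ _) =
      length ps , ℕ.≤-refl , long-periods-decay 1<e sorted (All.map proj₁ longs) n<p+p

    nnp-excess≤ : ∀ {c} → 1 ≤ n → length longs ≤ suc c → fromℕ (nnp _≟_ x) - e * ½ - 1ℚ Q.≤ fromℕ c
    nnp-excess≤ {c} 1≤n t≤1+c = begin
      fromℕ (nnp _≟_ x) - h - 1ℚ          ≡⟨ cong (λ m → fromℕ m - h - 1ℚ) (length-filter-∁ short? periods) ⟩
      fromℕ (s ℕ.+ t) - h - 1ℚ            ≤⟨ Q.+-monoˡ-≤ (Q.- 1ℚ) (Q.+-monoˡ-≤ (Q.- h) (fromℕ-mono-≤ (ℕ.+-monoʳ-≤ s t≤1+c))) ⟩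
      fromℕ (s ℕ.+ suc c) - h - 1ℚ        ≡⟨ cong (λ q → q - h - 1ℚ) (trans (fromℕ-+ s (suc c)) (cong (λ q → fromℕ s + q) (fromℕ-+ 1 c))) ⟩
      fromℕ s + (1ℚ + fromℕ c) - h - 1ℚ   ≡⟨ solve 3 (λ S H C → S :+ (con 1ℚ :+ C) :- H :- con 1ℚ := C :+ (S :- H)) refl (fromℕ s) h (fromℕ c) ⟩
      fromℕ c + (fromℕ s - h)             ≤⟨ Q.+-monoʳ-≤ (fromℕ c) (Q.+-monoˡ-≤ (Q.- h) s≤h) ⟩
      fromℕ c + (h - h)                   ≡⟨ solve 2 (λ C H → C :+ (H :- H) := C) refl (fromℕ c) h ⟩
      fromℕ c                             ∎
      where
      open Q.≤-Reasoning
      h = e * ½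
      s = length shorts
      t = length longs
      s≤h : fromℕ s Q.≤ h
      s≤h = short-periods-bound 1≤n (AllPairs.filter⁺ short? periods-sorted)
        (All.zipWith (λ ((isPer , _) , short) → isPer , short)
          (All.filter⁺ short? periods-nontrivial , All.all-filter short? periods))

    nnp-bound : Bordered _≟_ x →
      ∃[ c ] fromℕ (nnp _≟_ x) - e * ½ - 1ℚ Q.≤ fromℕ c × fromℕ 2 * e ^ c Q.≤ fromℕ n * (e - 1ℚ) ^ c
    nnp-bound bordered =
      let c , t≤1+c , decay = long-periods-count (1<ice bordered) 2≤n
                                (AllPairs.filter⁺ (∁? short?) periods-sorted)
                                (All.zipWith (λ (nontrivial , long) → nontrivial , ℕ.≰⇒> long)
                                  (All.filter⁺ (∁? short?) periods-nontrivial , All.all-filter (∁? short?) periods))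
      in c , nnp-excess≤ (ℕ.≤-trans (s≤s z≤n) 2≤n) t≤1+c , decay
      where
      2≤n : 2 ≤ n
      2≤n = ℕ.≤-trans (s≤s (s≤s z≤n)) (per<length x bordered)

theorem1 : {A : Set} (_≟_ : DecidableEquality A) (x : List A) →
    1 ≤ length x → Bordered _≟_ x →
    let e = ice _≟_ x
        n = length x
        k = ((+ nnp _≟_ x) / 1) - (e * ((+ 1) / 2)) - 1ℚ
    in (a b : ℕ) .{{_ : NonZero b}} → (+ a) / b Q.≤ k →
       (e ^ℚ a) * (((+ 2) / 1) ^ℚ b) Q.≤ (((+ n) / 1) ^ℚ b) * ((e - 1ℚ) ^ℚ a)
-- The hypothesis 1 ≤ length x is implied by Bordered.
theorem1 _≟_ x _ bordered a b a/b≤k =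
  let c , k≤c , decay = nnp-bound _≟_ x bordered
  in power-bound (length x) c a b (1<ice _≟_ x bordered) decay (Q.≤-trans a/b≤k k≤c)
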